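{- Let $k\ge 1$, let $G^k$ be as defined in the context, let $p$ be a shortest $(s,t)$-path in $G^k$ that contains $y^k_1$, and let $q$ be a shortest $(s,t)$-path in $G^k$ that contains $y^k_6$. Then the reconfiguration distance between $p$ and $q$ is at least $9(2^k-1)$.
   Context: Reconfiguration graph of shortest $(s,t)$-paths of a graph: its vertices are the shortest $(s,t)$-paths (viewed as vertex sequences), and two of them are adjacent iff, as sequences, they differ in exactly one position. The reconfiguration distance between two shortest paths is their distance in this graph (infinite if they lie in different components). The undirected graph $G^1$ has vertices $x^1_1,\dots,x^1_7$, $y^1_1,\dots,y^1_6$, $s$, $t$ and edges $x^1_iy^1_i$, $x^1_{i+1}y^1_i$, $y^1_it$ for $1\le i\le 6$, and $sx^1_i$ for $1\le i\le 7$. For $k\ge 2$, $G^k$ has vertex set $V(G^{k-1})\cup\{x^k_1,\dots,x^k_7,y^k_1,\dots,y^k_6\}$ and edge set consisting of: $x^k_iy^k_i$ and $x^k_{i+1}y^k_i$ for $1\le i\le 6$; $y^k_ix^{k-1}_j$ for $i\in\{1,3,5\}$ and $1\le j\le 7$; $y^k_2x^{k-1}_1$, $y^k_4x^{k-1}_7$, $y^k_6x^{k-1}_1$; all edges of $G^{k-1}$ not incident to $s$; and $sx^k_i$ for $1\le i\le 7$. -}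

module Defs where

open import Data.Nat using (ℕ; zero; suc; _≤_)
open import Data.Fin using (Fin; zero; suc; inject₁; fromℕ; #_)
open import Data.Empty using (⊥)
open import Data.List using (List; []; _∷_; length; head; last)
open import Data.Maybe using (just)
open import Data.Sum using (_⊎_)
open import Data.Product using (_×_)
open import Relation.Binary.PropositionalEquality using (_≡_; _≢_)
open import Data.List.Relation.Unary.Linked using (Linked)
open import Data.List.Relation.Unary.Unique.Propositional using (Unique)

-- Levels are indexed by Fin k: level j : Fin k is the
-- paper's level (toℕ j + 1).  Indices inside a level are 0-based:
-- x j i (i : Fin 7) is x^{j+1}_{i+1}, y j i (i : Fin 6) is y^{j+1}_{i+1}.
data V (k : ℕ) : Set where
  s t : V k
  x   : Fin k → Fin 7 → V k
  y   : Fin k → Fin 6 → V k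

-- Edges of G^k (one orientation each; adjacency is the symmetric closure).
data Edge : (k : ℕ) → V k → V k → Set where
  xy   : ∀ {k} (j : Fin k) (i : Fin 6) → Edge k (x j (inject₁ i)) (y j i)
  x'y  : ∀ {k} (j : Fin k) (i : Fin 6) → Edge k (x j (suc i)) (y j i)
  yt   : ∀ {m} (i : Fin 6) → Edge (suc m) (y zero i) t
  -- between level (j+1) (upper, suc j) and level j (lower, inject₁ j):
  -- y^{j+1}_i x^j_l for i ∈ {1,3,5}, all l
  y1x  : ∀ {m} (j : Fin m) (l : Fin 7) → Edge (suc m) (y (suc j) (# 0)) (x (inject₁ j) l)
  y3x  : ∀ {m} (j : Fin m) (l : Fin 7) → Edge (suc m) (y (suc j) (# 2)) (x (inject₁ j) l)
  y5x  : ∀ {m} (j : Fin m) (l : Fin 7) → Edge (suc m) (y (suc j) (# 4)) (x (inject₁ j) l)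
  y2x1 : ∀ {m} (j : Fin m) → Edge (suc m) (y (suc j) (# 1)) (x (inject₁ j) (# 0))
  y4x7 : ∀ {m} (j : Fin m) → Edge (suc m) (y (suc j) (# 3)) (x (inject₁ j) (# 6))
  y6x1 : ∀ {m} (j : Fin m) → Edge (suc m) (y (suc j) (# 5)) (x (inject₁ j) (# 0))
  sx   : ∀ {m} (i : Fin 7) → Edge (suc m) s (x (fromℕ m) i)

Adj : (k : ℕ) → V k → V k → Set
Adj k a b = Edge k a b ⊎ Edge k b a

IsSTPath : (k : ℕ) → List (V k) → Set
IsSTPath k p = head p ≡ just s × last p ≡ just t × Linked (Adj k) p × Unique p

IsShortest : (k : ℕ) → List (V k) → Set
IsShortest k p = IsSTPath k p × (∀ q → IsSTPath k q → length p ≤ length q)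

DiffOne : {A : Set} → List A → List A → Set
DiffOne [] [] = ⊥
DiffOne [] (_ ∷ _) = ⊥
DiffOne (_ ∷ _) [] = ⊥
DiffOne (a ∷ as) (b ∷ bs) = (a ≢ b × as ≡ bs) ⊎ (a ≡ b × DiffOne as bs)

ReconfAdj : (k : ℕ) → List (V k) → List (V k) → Set
ReconfAdj k p q = IsShortest k p × IsShortest k q × DiffOne p q

data Walk {A : Set} (R : A → A → Set) : A → A → ℕ → Set where
  []  : ∀ {a} → Walk R a a 0
  _∷_ : ∀ {a b c n} → R a b → Walk R b c n → Walk R a c (suc n)

-- Reconfiguration distance ≥ N (with distance ∞ if no walk exists):
-- every reconfiguration walk from p to q has length ≥ N.
ReconfDistAtLeast : (k : ℕ) → List (V k) → List (V k) → ℕ → Set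
ReconfDistAtLeast k p q N = ∀ L → Walk (ReconfAdj k) p q L → N ≤ L

-- Give t height 0, the vertices x^j, y^j of level j heights 2j and 2j − 1, and s height 2k + 1.
-- Every edge joins vertices of consecutive heights, and s reaches t in 2k + 1 steps, so a
-- shortest (s,t)-path descends through all levels, visiting one x and one y on each.
-- Read from the bottom level up, such a path gets a potential: a level above levels of
-- maximal potential G = 9(2^(j−1) − 1) and current (capped) potential u contributes
-- a + b + bonus, where x_(a+1), y_(b+1) are its vertices and the bonus is 0, 0, u, G, 2G − u,
-- 2G for b = 0, …, 5. The edges y_2 x_1, y_4 x_7 and y_6 x_1 to the level below force u = 0, G, 0
-- precisely where the bonus changes its formula, so every reconfiguration step changes the
-- potential by at most one, while it is at most 1 on paths through y^k_1 and at least
-- 9(2^k − 1) + 1 on paths through y^k_6.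

module Submission where

open import Defs
open import Data.Nat using (ℕ; zero; suc; _*_; _∸_; _^_; _+_; _≤_; _<_; z≤n; s≤s; _⊓_)
open import Data.Nat.Properties
open import Data.Nat.Tactic.RingSolver using (solve-∀)
open import Data.Fin using (Fin; zero; suc; fromℕ; #_; toℕ; inject₁)
open import Data.Fin.Properties using (toℕ-inject₁; toℕ-fromℕ; toℕ-injective; toℕ<n)
  renaming (suc-injective to Fin-suc-injective)
open import Data.Fin.Induction using (<-weakInduction)
open import Data.List using (List; []; _∷_; length; last; drop)
open import Data.List.Membership.Propositional using (_∈_)
open import Data.List.Relation.Unary.Any using (here; there)
open import Data.List.Relation.Unary.All as All using (All; []; _∷_)
open import Data.List.Relation.Unary.AllPairs using ([]; _∷_)
open import Data.List.Relation.Unary.Linked as Linked using (Linked; [-]; _∷_)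
open import Data.List.Relation.Unary.Unique.Propositional using (Unique)
open import Data.Maybe using (just)
open import Data.Maybe.Properties using (just-injective)
open import Data.Sum using (_⊎_; inj₁; inj₂)
open import Data.Product using (Σ; ∃₂; _×_; _,_; proj₁; proj₂)
open import Data.Empty using (⊥-elim)
open import Relation.Binary.PropositionalEquality
open import Function using (_∘_)

Near : ℕ → ℕ → Set
Near a b = a ≤ suc b × b ≤ suc a

near-refl : ∀ a → Near a a
near-refl a = n≤1+n a , n≤1+n a

near-sym : ∀ {a b} → Near a b → Near b a
near-sym (p , q) = q , p

near-suc : ∀ a → Near a (suc a)
near-suc a = m≤n⇒m≤1+n (n≤1+n a) , ≤-refl

+-nearˡ : ∀ c {a b} → Near a b → Near (c + a) (c + b)
+-nearˡ c {a} {b} (p , q) =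
  subst (c + a ≤_) (+-suc c b) (+-monoʳ-≤ c p) , subst (c + b ≤_) (+-suc c a) (+-monoʳ-≤ c q)

+-nearʳ : ∀ c {a b} → Near a b → Near (a + c) (b + c)
+-nearʳ c (p , q) = +-monoˡ-≤ c p , +-monoˡ-≤ c q

⊓-near : ∀ G {a b} → Near a b → Near (G ⊓ a) (G ⊓ b)
⊓-near G (p , q) = ⊓-mono-≤ (n≤1+n G) p , ⊓-mono-≤ (n≤1+n G) q

suc-∸-≤ : ∀ m n → suc m ∸ n ≤ suc (m ∸ n)
suc-∸-≤ m       zero    = ≤-refl
suc-∸-≤ zero    (suc n) = ≤-trans (m∸n≤m 0 n) z≤n
suc-∸-≤ (suc m) (suc n) = suc-∸-≤ m n

∸-near : ∀ G {a b} → Near a b → Near (G ∸ a) (G ∸ b)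
∸-near G {a} {b} (p , q) =
  ≤-trans (∸-monoʳ-≤ (suc G) q) (suc-∸-≤ G b) , ≤-trans (∸-monoʳ-≤ (suc G) p) (suc-∸-≤ G a)

walk-potential : ∀ {A : Set} {R : A → A → Set} (Φ : A → ℕ)
  → (∀ {a b} → R a b → Φ b ≤ suc (Φ a))
  → ∀ {a b L} → Walk R a b L → Φ b ≤ L + Φ a
walk-potential Φ step []                  = ≤-refl
walk-potential Φ step (_∷_ {a = a} {b = a′} {n = L} r w) =
  ≤-trans (walk-potential Φ step w) (subst (L + Φ a′ ≤_) (+-suc L (Φ a)) (+-monoʳ-≤ L (step r)))

data Countdown {A : Set} (d : A → ℕ) : ℕ → List A → Set where
  [_] : ∀ {v} → d v ≡ 0 → Countdown d 0 (v ∷ [])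
  _∷_ : ∀ {k v l} → d v ≡ suc k → Countdown d k l → Countdown d (suc k) (v ∷ l)

countdown-≤ : ∀ {A} {d : A → ℕ} {k l} → Countdown d k l → All (λ w → d w ≤ k) l
countdown-≤ [ e ]    = ≤-reflexive e ∷ []
countdown-≤ (e ∷ c) = ≤-reflexive e ∷ All.map (m≤n⇒m≤1+n) (countdown-≤ c)

countdown-unique : ∀ {A} {d : A → ℕ} {k l} → Countdown d k l → Unique l
countdown-unique [ _ ]   = [] ∷ []
countdown-unique {d = d} (e ∷ c) =
  All.map (λ dw≤k v≡w → 1+n≰n (subst (_≤ _) e (subst (λ u → d u ≤ _) (sym v≡w) dw≤k))) (countdown-≤ c)
  ∷ countdown-unique c

module _ {A : Set} {R : A → A → Set} (d : A → ℕ) (lipschitz : ∀ {a b} → R a b → d a ≤ suc (d b)) where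

  path-length-≥ : ∀ {z v l} → d z ≡ 0 → Linked R (v ∷ l) → last (v ∷ l) ≡ just z → d v ≤ length l
  path-length-≥ dz [-]        refl = ≤-reflexive dz
  path-length-≥ dz (r ∷ lk) e  = ≤-trans (lipschitz r) (s≤s (path-length-≥ dz lk e))

  tight-path-countdown : ∀ {z v l} → d z ≡ 0 → Linked R (v ∷ l) → last (v ∷ l) ≡ just z
    → length l ≤ d v → Countdown d (d v) (v ∷ l)
  tight-path-countdown dz [-] refl _ = subst (λ k → Countdown d k _) (sym dz) [ dz ]
  tight-path-countdown {v = v} {l = w ∷ l} dz (r ∷ lk) e len≤ =
    subst (λ k → Countdown d k _) (sym dv) (dv ∷ tight-path-countdown dz lk e (≤-pred (subst (_ ≤_) dv len≤)))
    where
    dv : d v ≡ suc (d w)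
    dv = ≤-antisym (lipschitz r) (≤-trans (s≤s (path-length-≥ dz lk e)) len≤)

-- The 0-based indices of adjacent vertices x_a, y_b of one level.
data Rung : ℕ → ℕ → Set where
  same : ∀ b → Rung b b
  next : ∀ b → Rung (suc b) b

rung-nearˡ : ∀ {a a′ b} → Rung a b → Rung a′ b → Near a a′
rung-nearˡ (same b) (same b) = near-refl b
rung-nearˡ (same b) (next b) = near-suc b
rung-nearˡ (next b) (same b) = near-sym (near-suc b)
rung-nearˡ (next b) (next b) = near-refl (suc b)

rung-nearʳ : ∀ {a b b′} → Rung a b → Rung a b′ → Near b b′
rung-nearʳ (same b) (same b)      = near-refl b
rung-nearʳ (same _) (next b′)     = near-sym (near-suc b′)
rung-nearʳ (next b) (same _)      = near-suc b
rung-nearʳ (next b) (next b)      = near-refl b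

rung-zero : ∀ {b} → Rung 0 b → b ≡ 0
rung-zero (same 0) = refl

rung-last : ∀ {m b} → Rung (suc m) b → b < suc m → b ≡ m
rung-last (same _) b<b = ⊥-elim (<-irrefl refl b<b)
rung-last (next _) _   = refl

rung-split : ∀ {a b b′} → Rung a b → Rung a b′ → b ≡ b′ ⊎ b′ ≡ suc b ⊎ b ≡ suc b′
rung-split (same b) (same b)  = inj₁ refl
rung-split (same _) (next b′) = inj₂ (inj₂ refl)
rung-split (next b) (same _)  = inj₂ (inj₁ refl)
rung-split (next b) (next b)  = inj₁ refl

-- What the y-index b of a level forces on a quantity v of the level below:
-- v sits at lo under y_2 and y_6 (indices 1 and 5), and at hi under y_4.
Pinned : {A : Set} → A → A → Fin 6 → A → Set
Pinned lo hi b v = (b ≡ # 1 ⊎ b ≡ # 5 → v ≡ lo) × (b ≡ # 3 → v ≡ hi)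

pinned-transport : ∀ {A B : Set} {lo hi : A} {lo′ hi′ : B} {b v w}
  → (v ≡ lo → w ≡ lo′) → (v ≡ hi → w ≡ hi′) → Pinned lo hi b v → Pinned lo′ hi′ b w
pinned-transport f g (p , q) = (λ e → f (p e)) , (λ e → g (q e))

bonus : ℕ → Fin 6 → ℕ → ℕ
bonus G zero                                   u = 0
bonus G (suc zero)                             u = 0
bonus G (suc (suc zero))                       u = u
bonus G (suc (suc (suc zero)))                 u = G
bonus G (suc (suc (suc (suc zero))))           u = G + (G ∸ u)
bonus G (suc (suc (suc (suc (suc zero)))))     u = G + G

bonus-near : ∀ G b {u u′} → Near u u′ → Near (bonus G b u) (bonus G b u′)
bonus-near G zero                               _ = near-refl 0
bonus-near G (suc zero)                         _ = near-refl 0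
bonus-near G (suc (suc zero))                   p = p
bonus-near G (suc (suc (suc zero)))             _ = near-refl G
bonus-near G (suc (suc (suc (suc zero))))       p = +-nearˡ G (∸-near G p)
bonus-near G (suc (suc (suc (suc (suc zero))))) _ = near-refl (G + G)

bonus-continuous : ∀ G u (c : Fin 5) → Pinned 0 G (inject₁ c) u → Pinned 0 G (suc c) u
  → bonus G (inject₁ c) u ≡ bonus G (suc c) u
bonus-continuous G u zero                         _ _ = refl
bonus-continuous G u (suc zero)                   p _ = sym (proj₁ p (inj₁ refl))
bonus-continuous G u (suc (suc zero))             _ p = proj₂ p refl
bonus-continuous G u (suc (suc (suc zero)))       p _ rewrite proj₂ p refl | n∸n≡0 G = sym (+-identityʳ G)
bonus-continuous G u (suc (suc (suc (suc zero)))) _ p rewrite proj₁ p (inj₂ refl) = refl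

bonus-consecutive : ∀ G u (b b′ : Fin 6) → toℕ b′ ≡ suc (toℕ b) → Pinned 0 G b u → Pinned 0 G b′ u
  → bonus G b u ≡ bonus G b′ u
bonus-consecutive G u b (suc c) e
  with toℕ-injective {i = b} {j = inject₁ c} (trans (suc-injective (sym e)) (sym (toℕ-inject₁ c)))
... | refl = bonus-continuous G u c

bonus-agree : ∀ G u {a} (b b′ : Fin 6) → Rung a (toℕ b) → Rung a (toℕ b′) → Pinned 0 G b u → Pinned 0 G b′ u
  → bonus G b u ≡ bonus G b′ u
bonus-agree G u b b′ r r′ p p′ with rung-split r r′
... | inj₁ e        rewrite toℕ-injective {i = b} {j = b′} e = refl
... | inj₂ (inj₁ e) = bonus-consecutive G u b b′ e p p′
... | inj₂ (inj₂ e) = sym (bonus-consecutive G u b′ b e p′ p)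

span : ℕ → ℕ
span zero    = 0
span (suc m) = 9 + (span m + span m)

cap : ℕ → ℕ → ℕ
cap m v = span m ⊓ v

inject₁≢suc : ∀ {m} (j : Fin m) → inject₁ j ≢ suc j
inject₁≢suc zero    ()
inject₁≢suc (suc j) e = inject₁≢suc j (Fin-suc-injective e)

module Graph (n : ℕ) where

  K : ℕ
  K = suc n

  height : V K → ℕ
  height s       = suc (2 * K)
  height t       = 0
  height (x j _) = 2 + 2 * toℕ j
  height (y j _) = 1 + 2 * toℕ j

  height-cross : ∀ (j : Fin n) → height (y (suc j) zero) ≡ suc (height (x (inject₁ j) zero))
  height-cross j = cong suc (trans (*-suc 2 (toℕ j)) (cong (λ i → 2 + 2 * i) (sym (toℕ-inject₁ j))))

  edge-height : ∀ {u v} → Edge K u v → height u ≡ suc (height v)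
  edge-height (xy _ _)   = refl
  edge-height (x'y _ _)  = refl
  edge-height (yt _)     = refl
  edge-height (y1x j _)  = height-cross j
  edge-height (y3x j _)  = height-cross j
  edge-height (y5x j _)  = height-cross j
  edge-height (y2x1 j)   = height-cross j
  edge-height (y4x7 j)   = height-cross j
  edge-height (y6x1 j)   = height-cross j
  edge-height (sx _)     = cong suc (trans (*-suc 2 n) (cong (λ i → 2 + 2 * i) (sym (toℕ-fromℕ n))))

  adj-height : ∀ {u v} → Adj K u v → height u ≤ suc (height v)
  adj-height (inj₁ e) = ≤-reflexive (edge-height e)
  adj-height (inj₂ e) = ≤-trans (n≤1+n _) (≤-trans (≤-reflexive (sym (edge-height e))) (n≤1+n _))

  ShortPathFrom : V K → Set
  ShortPathFrom v = Σ (List (V K)) λ l → Linked (Adj K) (v ∷ l) × last (v ∷ l) ≡ just t × length l ≤ height v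

  short-path-t : ShortPathFrom t
  short-path-t = [] , [-] , refl , z≤n

  short-path-edge : ∀ {u v} → Edge K u v → ShortPathFrom v → ShortPathFrom u
  short-path-edge e (l , lk , la , len) =
    _ ∷ l , inj₁ e ∷ lk , la , subst (suc (length l) ≤_) (sym (edge-height e)) (s≤s len)

  short-path-x : ∀ j → ShortPathFrom (x j zero)
  short-path-x = <-weakInduction (λ j → ShortPathFrom (x j zero))
    (short-path-edge (xy zero zero) (short-path-edge (yt zero) short-path-t))
    (λ i → short-path-edge (xy (suc i) zero) ∘ short-path-edge (y1x i zero))

  short-path-s : ShortPathFrom s
  short-path-s = short-path-edge (sx zero) (short-path-x (fromℕ n))

  data Layered : ℕ → List (V K) → Set where
    [t]   : Layered 0 (t ∷ [])
    layer : ∀ {m r} j a b → toℕ j ≡ m → Layered m r → Layered (suc m) (x j a ∷ y j b ∷ r)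

  height≡0 : ∀ {v} → height v ≡ 0 → v ≡ t
  height≡0 {t} _ = refl

  even-height : ∀ {v m} → height v ≡ 2 + 2 * m → ∃₂ λ j a → toℕ j ≡ m × v ≡ x j a
  even-height {s}     {m} e = ⊥-elim (even≢odd K m (suc-injective e))
  even-height {x j a} {m} e = j , a , *-cancelˡ-≡ _ _ 2 (suc-injective (suc-injective e)) , refl
  even-height {y j _} {m} e = ⊥-elim (even≢odd (toℕ j) m (suc-injective e))

  odd-height : ∀ {v m} → m < K → height v ≡ 1 + 2 * m → ∃₂ λ j b → toℕ j ≡ m × v ≡ y j b
  odd-height {s}     {m} m<K e = ⊥-elim (<-irrefl (sym (*-cancelˡ-≡ K m 2 (suc-injective e))) m<K)
  odd-height {x j _} {m} _   e = ⊥-elim (even≢odd m (toℕ j) (sym (suc-injective e)))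
  odd-height {y j b} {m} _   e = j , b , *-cancelˡ-≡ _ _ 2 (suc-injective e) , refl

  countdown-layered : ∀ m {l} → m ≤ K → Countdown height (2 * m) l → Layered m l
  countdown-layered zero    _ ([_] {v} e) with height≡0 {v} e
  ... | refl = [t]
  countdown-layered (suc m) {l} m<K c with subst (λ k → Countdown height k l) (*-suc 2 m) c
  ... | _∷_ {v = v} ev (_∷_ {v = w} ew c′) with even-height {v} {m} ev | odd-height {w} {m} m<K ew
  ... | j , a , refl , refl | j′ , b , ej′ , refl with toℕ-injective ej′
  ... | refl = layer j a b refl (countdown-layered (toℕ j) (<⇒≤ m<K) c′)

  tight-countdown : ∀ {v l} → Linked (Adj K) (v ∷ l) → last (v ∷ l) ≡ just t → length l ≤ height v
    → Countdown height (height v) (v ∷ l)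
  tight-countdown = tight-path-countdown height adj-height refl

  tight-st-path : ∀ {l} → Linked (Adj K) (s ∷ l) → last (s ∷ l) ≡ just t → length l ≤ height s
    → IsSTPath K (s ∷ l)
  tight-st-path lk la len = refl , la , lk , countdown-unique (tight-countdown lk la len)

  shortest-length : ∀ {p} → IsShortest K p → length p ≤ suc (height s)
  shortest-length (_ , minimal) with short-path-s
  ... | _ , lk , la , len = ≤-trans (minimal _ (tight-st-path lk la len)) (s≤s len)

  data LayeredPath : List (V K) → Set where
    layered-path : ∀ {l} → Layered K l → Linked (Adj K) l → LayeredPath (s ∷ l)

  shortest-layered : ∀ {p} → IsShortest K p → LayeredPath p
  shortest-layered {v ∷ l} sp@((hd , la , lk , _) , _) with just-injective hd
  ... | refl with tight-countdown lk la (≤-pred (shortest-length sp))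
  ... | _ ∷ c = layered-path (countdown-layered K ≤-refl c) (Linked.tail lk)

  rung : ∀ {j j′ a b} → j ≡ j′ → Adj K (x j a) (y j′ b) → Rung (toℕ a) (toℕ b)
  rung _ (inj₁ (xy _ i))  = subst (λ k → Rung k (toℕ i)) (sym (toℕ-inject₁ i)) (same (toℕ i))
  rung _ (inj₁ (x'y _ i)) = next (toℕ i)
  rung e (inj₂ (y1x j _)) = ⊥-elim (inject₁≢suc j e)
  rung e (inj₂ (y3x j _)) = ⊥-elim (inject₁≢suc j e)
  rung e (inj₂ (y5x j _)) = ⊥-elim (inject₁≢suc j e)
  rung e (inj₂ (y2x1 j))  = ⊥-elim (inject₁≢suc j e)
  rung e (inj₂ (y4x7 j))  = ⊥-elim (inject₁≢suc j e)
  rung e (inj₂ (y6x1 j))  = ⊥-elim (inject₁≢suc j e)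

  cross-pinned : ∀ {j j′ b c} → toℕ j ≡ suc (toℕ j′) → Adj K (y j b) (x j′ c) → Pinned zero (# 6) b c
  cross-pinned _ (inj₁ (y1x _ _)) = (λ { (inj₁ ()) ; (inj₂ ()) }) , λ ()
  cross-pinned _ (inj₁ (y3x _ _)) = (λ { (inj₁ ()) ; (inj₂ ()) }) , λ ()
  cross-pinned _ (inj₁ (y5x _ _)) = (λ { (inj₁ ()) ; (inj₂ ()) }) , λ ()
  cross-pinned _ (inj₁ (y2x1 _))  = (λ _ → refl) , λ ()
  cross-pinned _ (inj₁ (y4x7 _))  = (λ { (inj₁ ()) ; (inj₂ ()) }) , λ _ → refl
  cross-pinned _ (inj₁ (y6x1 _))  = (λ _ → refl) , λ ()
  cross-pinned e (inj₂ (xy _ _))  = ⊥-elim (1+n≢n (sym e))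
  cross-pinned e (inj₂ (x'y _ _)) = ⊥-elim (1+n≢n (sym e))

  potential : ℕ → List (V K) → ℕ
  potential (suc m) (x _ a ∷ y _ b ∷ r) = toℕ a + toℕ b + bonus (span m) b (cap m (potential m r))
  potential _       _                   = 0

  cap-at-x₁ : ∀ m {j e} r → Rung 0 (toℕ e) → cap (suc m) (potential (suc m) (x j zero ∷ y j e ∷ r)) ≡ 0
  cap-at-x₁ _ {e = e} _ r with toℕ-injective {i = e} {j = zero} (rung-zero r)
  ... | refl = refl

  cap-at-x₇ : ∀ m {j e} r → Rung 6 (toℕ e) → cap (suc m) (potential (suc m) (x j (# 6) ∷ y j e ∷ r)) ≡ span (suc m)
  cap-at-x₇ m {e = e} _ r with toℕ-injective {i = e} {j = # 5} (rung-last r (toℕ<n e))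
  ... | refl = m≤n⇒m⊓n≡m (m≤n+m (span (suc m)) 2)

  lower-pinned : ∀ {m j b r} → toℕ j ≡ m → Layered m r → Linked (Adj K) (y j b ∷ r)
    → Pinned 0 (span m) b (cap m (potential m r))
  lower-pinned _  [t]                     _              = (λ _ → refl) , (λ _ → refl)
  lower-pinned ej (layer {m} {r′} j′ c e ej′ _) (yx ∷ xy′ ∷ _) =
    pinned-transport (λ { refl → cap-at-x₁ m {j′} r′ r }) (λ { refl → cap-at-x₇ m {j′} r′ r })
      (cross-pinned (trans ej (cong suc (sym ej′))) yx)
    where
    r : Rung (toℕ c) (toℕ e)
    r = rung refl xy′

  potential-near : ∀ {m l l′} → Layered m l → Linked (Adj K) l → Layered m l′ → Linked (Adj K) l′
    → DiffOne l l′ → Near (potential m l) (potential m l′)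
  potential-near [t] _ [t] _ _ = near-refl 0
  potential-near {suc m} (layer j a b _ _) lk (layer _ a′ _ _ _) lk′ (inj₁ (_ , refl)) =
    +-nearʳ _ (+-nearʳ (toℕ b) (rung-nearˡ (rung refl (Linked.head lk)) (rung refl (Linked.head lk′))))
  potential-near {suc m} (layer {r = r} j a b ej lr) lk (layer _ _ b′ _ lr′) lk′ (inj₂ (refl , inj₁ (_ , refl))) =
    subst (λ z → Near (toℕ a + toℕ b + bonus G b u) (toℕ a + toℕ b′ + z))
      (bonus-agree G u b b′ rb rb′ (lower-pinned ej lr (Linked.tail lk)) (lower-pinned ej lr′ (Linked.tail lk′)))
      (+-nearʳ (bonus G b u) (+-nearˡ (toℕ a) (rung-nearʳ rb rb′)))
    where
    G u : ℕ
    G = span m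
    u = cap m (potential m r)
    rb : Rung (toℕ a) (toℕ b)
    rb = rung refl (Linked.head lk)
    rb′ : Rung (toℕ a) (toℕ b′)
    rb′ = rung refl (Linked.head lk′)
  potential-near {suc m} (layer j a b _ lr) lk (layer _ _ _ _ lr′) lk′ (inj₂ (refl , inj₂ (refl , d))) =
    +-nearˡ (toℕ a + toℕ b) (bonus-near (span m) b (⊓-near (span m)
      (potential-near lr (Linked.tail (Linked.tail lk)) lr′ (Linked.tail (Linked.tail lk′)) d)))

  y-below : ∀ {m r j c} → Layered m r → y j c ∈ r → toℕ j < m
  y-below [t]                 (here ())
  y-below (layer _ _ _ ej _)  (there (here refl))  = s≤s (≤-reflexive ej)
  y-below (layer _ _ _ _ lr)  (there (there mem)) = m<n⇒m<1+n (y-below lr mem)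

  top-y : ∀ {j a b r c} → Layered n r → y (fromℕ n) c ∈ (s ∷ x j a ∷ y j b ∷ r) → b ≡ c
  top-y _  (there (there (here refl)))  = refl
  top-y lr (there (there (there mem))) = ⊥-elim (<-irrefl (toℕ-fromℕ n) (y-below lr mem))

  pathPotential : List (V K) → ℕ
  pathPotential p = potential K (drop 1 p)

  reconf-potential : ∀ {p p′} → ReconfAdj K p p′ → pathPotential p′ ≤ suc (pathPotential p)
  reconf-potential (sp , sp′ , d) with shortest-layered sp | shortest-layered sp′ | d
  ... | layered-path _  _  | layered-path _   _   | inj₁ (s≢s , _) = ⊥-elim (s≢s refl)
  ... | layered-path lp lk | layered-path lp′ lk′ | inj₂ (_ , d′)   = proj₂ (potential-near lp lk lp′ lk′ d′)

  potential-at-y₁ : ∀ {p} → IsShortest K p → y (fromℕ n) (# 0) ∈ p → pathPotential p ≤ 1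
  potential-at-y₁ sp mem with shortest-layered sp
  ... | layered-path (layer _ _ _ _ lr) lk with top-y lr mem
  ... | refl = start (rung refl (Linked.head lk))
    where
    start : ∀ {a} → Rung a 0 → a + 0 + 0 ≤ 1
    start (same 0) = z≤n
    start (next 0) = ≤-refl

  potential-at-y₆ : ∀ {q} → IsShortest K q → y (fromℕ n) (# 5) ∈ q → suc (span K) ≤ pathPotential q
  potential-at-y₆ sq mem with shortest-layered sq
  ... | layered-path (layer _ _ _ _ lr) lk with top-y lr mem
  ... | refl = end (rung refl (Linked.head lk))
    where
    end : ∀ {a} → Rung a 5 → 10 + (span n + span n) ≤ a + 5 + (span n + span n)
    end (same 5) = ≤-refl
    end (next 5) = n≤1+n _

span-closed : ∀ m → span m ≡ 9 * (2 ^ m ∸ 1)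
span-closed m = begin
  span m                 ≡⟨ m+n∸n≡m (span m) 9 ⟨
  span m + 9 ∸ 9         ≡⟨ cong (_∸ 9) (span+9 m) ⟩
  9 * 2 ^ m ∸ 9          ≡⟨ *-distribˡ-∸ 9 (2 ^ m) 1 ⟨
  9 * (2 ^ m ∸ 1)        ∎
  where
  open ≡-Reasoning
  span+9 : ∀ m → span m + 9 ≡ 9 * 2 ^ m
  span+9 zero    = refl
  span+9 (suc m) = begin
    9 + (span m + span m) + 9     ≡⟨ regroup (span m) ⟩
    (span m + 9) + (span m + 9)   ≡⟨ cong (λ z → z + z) (span+9 m) ⟩
    9 * 2 ^ m + 9 * 2 ^ m         ≡⟨ distribute (2 ^ m) ⟩
    9 * (2 * 2 ^ m)               ∎
    where
    regroup : ∀ f → 9 + (f + f) + 9 ≡ (f + 9) + (f + 9)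
    regroup = solve-∀
    distribute : ∀ p → 9 * p + 9 * p ≡ 9 * (2 * p)
    distribute = solve-∀

lemma1 : (n : ℕ) (p q : List (V (suc n)))
    → IsShortest (suc n) p → y (fromℕ n) (# 0) ∈ p
    → IsShortest (suc n) q → y (fromℕ n) (# 5) ∈ q
    → ReconfDistAtLeast (suc n) p q (9 * (2 ^ suc n ∸ 1))
lemma1 n p q sp mp sq mq L w = subst (_≤ L) (span-closed (suc n)) (≤-pred (begin
  suc (span (suc n))     ≤⟨ potential-at-y₆ sq mq ⟩
  pathPotential q        ≤⟨ walk-potential pathPotential reconf-potential w ⟩
  L + pathPotential p    ≤⟨ +-monoʳ-≤ L (potential-at-y₁ sp mp) ⟩
  L + 1                  ≡⟨ +-comm L 1 ⟩
  suc L                  ∎))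
  where
  open Graph n
  open ≤-Reasoning
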